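{- Let $n\ge 1$ and let $M$ be a perfect matching of $G_n$. Then $f(G_n,M)=s(M)$.
   Context: For a positive integer $n$, $G_n$ is the plane graph (a polyomino graph) with vertex set $\{u_0,v_0\}\cup\{u_i,v_i,w_i,z_i: 1\le i\le 2n\}$, drawn with $w_i$ at $(i,3)$, $u_i$ at $(i,2)$, $v_i$ at $(i,1)$, $z_i$ at $(i,0)$ (and $u_0$ at $(0,2)$, $v_0$ at $(0,1)$), and edge set consisting of: $u_{i-1}u_i$ and $v_{i-1}v_i$ for $1\le i\le 2n$; $u_iv_i$ for $0\le i\le 2n$; $w_iu_i$ and $v_iz_i$ for $1\le i\le 2n$; $w_{2j-1}w_{2j}$ and $z_{2j-1}z_{2j}$ for $1\le j\le n$. Its $4n$ interior faces are unit squares. For a perfect matching $M$ of a graph $G$, a set $S\subseteq M$ is a forcing set of $M$ if no other perfect matching of $G$ contains $S$; the forcing number $f(G,M)$ is the minimum size of a forcing set of $M$. A cycle is $M$-alternating if its edges lie alternately in $M$ and outside $M$. An $M$-resonant set is a set of pairwise vertex-disjoint square faces whose boundaries are $M$-alternating cycles, and $s(M)$ denotes the maximum size of an $M$-resonant set. -}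

module Defs where

open import Data.Nat using (ℕ; suc; _*_)
open import Data.Fin using (Fin; zero; suc; inject₁; combine)
open import Data.Bool using (Bool; true; false)
open import Data.Product using (_×_; _,_; proj₁; proj₂; Σ; ∃-syntax)
open import Data.Sum using (_⊎_)
open import Data.Empty using (⊥)
open import Data.List using (List; length)
open import Data.List.Relation.Unary.All using (All)
open import Data.List.Relation.Unary.AllPairs using (AllPairs)
open import Data.List.Relation.Unary.Unique.Propositional using (Unique)
open import Relation.Binary.PropositionalEquality using (_≡_)
open import Data.Nat using (_≤_)

-- Columns are 0 .. 2n; we write 2n as  n * 2  (so that Fin.combine gives 2j+b).
-- Vertices of G_n:
--   U i  = u_i  (i = 0..2n),   V i = v_i (i = 0..2n)
--   W i  = w_{i+1}, Z i = z_{i+1}   (i = 0..2n-1)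
data Vtx (n : ℕ) : Set where
  U V : Fin (suc (n * 2)) → Vtx n
  W Z : Fin (n * 2) → Vtx n

-- Edges of G_n:
--   uu i = u_i u_{i+1},  vv i = v_i v_{i+1}     (i = 0..2n-1)
--   uv i = u_i v_i                              (i = 0..2n)
--   wu i = w_{i+1} u_{i+1},  vz i = v_{i+1} z_{i+1}  (i = 0..2n-1)
--   ww j = w_{2j+1} w_{2j+2},  zz j = z_{2j+1} z_{2j+2}  (j = 0..n-1)
data Edge (n : ℕ) : Set where
  uu vv : Fin (n * 2) → Edge n
  uv    : Fin (suc (n * 2)) → Edge n
  wu vz : Fin (n * 2) → Edge n
  ww zz : Fin n → Edge n

even odd : {n : ℕ} → Fin n → Fin (n * 2)
even j = combine j zero
odd  j = combine j (suc zero)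

ends : {n : ℕ} → Edge n → Vtx n × Vtx n
ends (uu i) = U (inject₁ i) , U (suc i)
ends (vv i) = V (inject₁ i) , V (suc i)
ends (uv i) = U i , V i
ends (wu i) = W i , U (suc i)
ends (vz i) = V (suc i) , Z i
ends (ww j) = W (even j) , W (odd j)
ends (zz j) = Z (even j) , Z (odd j)

Incident : {n : ℕ} → Edge n → Vtx n → Set
Incident e x = (proj₁ (ends e) ≡ x) ⊎ (proj₂ (ends e) ≡ x)

EdgeSet : ℕ → Set
EdgeSet n = Edge n → Bool

IsPerfectMatching : {n : ℕ} → EdgeSet n → Set
IsPerfectMatching {n} M =
  (x : Vtx n) → Σ (Edge n) λ e → (M e ≡ true) × Incident e x ×
    ((e' : Edge n) → M e' ≡ true → Incident e' x → e' ≡ e)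

IsForcingSet : {n : ℕ} → EdgeSet n → List (Edge n) → Set
IsForcingSet {n} M S =
  Unique S × All (λ e → M e ≡ true) S ×
  ((M' : EdgeSet n) → IsPerfectMatching M' → All (λ e → M' e ≡ true) S →
     (e : Edge n) → M' e ≡ M e)

ForcingNumberIs : {n : ℕ} → EdgeSet n → ℕ → Set
ForcingNumberIs {n} M k =
  (Σ (List (Edge n)) λ S → IsForcingSet M S × length S ≡ k) ×
  ((S : List (Edge n)) → IsForcingSet M S → k ≤ length S)

-- Interior (square) faces of G_n, each with its 4 boundary edges in cyclic order.
--   mid i : u_i u_{i+1} v_{i+1} v_i                  (i = 0..2n-1)
--   top j : w_{2j+1} w_{2j+2} u_{2j+2} u_{2j+1}      (j = 0..n-1)
--   bot j : v_{2j+1} v_{2j+2} z_{2j+2} z_{2j+1}      (j = 0..n-1)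
data Face (n : ℕ) : Set where
  mid : Fin (n * 2) → Face n
  top bot : Fin n → Face n

boundary : {n : ℕ} → Face n → Edge n × Edge n × Edge n × Edge n
boundary (mid i) = uu i , uv (suc i) , vv i , uv (inject₁ i)
boundary (top j) = ww j , wu (odd j) , uu (odd j) , wu (even j)
boundary (bot j) = zz j , vz (odd j) , vv (odd j) , vz (even j)

OnFace : {n : ℕ} → Face n → Vtx n → Set
OnFace f x with boundary f
... | e₁ , e₂ , e₃ , e₄ =
  Incident e₁ x ⊎ Incident e₂ x ⊎ Incident e₃ x ⊎ Incident e₄ x

VertexDisjoint : {n : ℕ} → Face n → Face n → Set
VertexDisjoint {n} f g = (x : Vtx n) → OnFace f x → OnFace g x → ⊥

Alternating : {n : ℕ} → EdgeSet n → Face n → Set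
Alternating M f with boundary f
... | e₁ , e₂ , e₃ , e₄ =
  (M e₁ ≡ true × M e₂ ≡ false × M e₃ ≡ true × M e₄ ≡ false) ⊎
  (M e₁ ≡ false × M e₂ ≡ true × M e₃ ≡ false × M e₄ ≡ true)

-- M-resonant set: pairwise vertex-disjoint faces with M-alternating boundaries
-- (pairwise disjointness forces the list to be duplicate-free)
IsResonantSet : {n : ℕ} → EdgeSet n → List (Face n) → Set
IsResonantSet M R = AllPairs VertexDisjoint R × All (Alternating M) R

ResonanceNumberIs : {n : ℕ} → EdgeSet n → ℕ → Set
ResonanceNumberIs {n} M k =
  (Σ (List (Face n)) λ R → IsResonantSet M R × length R ≡ k) ×
  ((R : List (Face n)) → IsResonantSet M R → length R ≤ k)

{-# OPTIONS --safe #-}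

-- Flipping the boundary of an M-alternating face gives another perfect matching, so every
-- forcing set of M contains an edge of every M-alternating face. The faces of a resonant set
-- are vertex-disjoint, so these edges are distinct and s(M) ≤ f(G_n, M).
--
-- Conversely, choose every alternating top and bottom square, and the alternating middle
-- squares greedily from left to right, skipping those that touch a square already chosen.
-- The chosen squares form a resonant set R. Take for each of them the M-edge at a fixed
-- corner; sweeping the columns from left to right, one checks vertex by vertex that every
-- perfect matching containing these |R| edges agrees with M. Hence f(G_n, M) ≤ |R| ≤ s(M).

module Submission where

open import Defs
open import Data.Nat as ℕ using (ℕ; zero; suc; _≤_; _<_; z≤n; s≤s; _*_)
import Data.Nat.Properties as ℕ
open import Data.Fin as Fin using (Fin; zero; suc; inject₁; combine; toℕ; remQuot)
import Data.Fin.Properties as Fin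
open import Data.Bool using (Bool; true; false; not; _∧_; _∨_; if_then_else_)
open import Data.Bool.Properties
  using (∧-conicalˡ; ∧-conicalʳ; ∨-conicalˡ; ∨-conicalʳ; not-¬; ¬-not; not-involutive) renaming (_≟_ to _≟ᴮ_)
open import Function using (id; _∘_)
open import Data.Product using (Σ; _×_; _,_; proj₁; proj₂; ∃-syntax; uncurry)
open import Data.Sum using (_⊎_; inj₁; inj₂; [_,_])
import Data.Sum.Properties as Sum
open import Data.Empty using (⊥; ⊥-elim)
open import Data.List using (List; []; _∷_; length; map; filter; _++_; allFin)
open import Data.List.Properties using (length-map; length-removeAt′)
open import Data.List.Relation.Unary.All as All using (All; []; _∷_)
open import Data.List.Relation.Unary.All.Properties using (¬All⇒Any¬; all-filter)
import Data.List.Relation.Unary.All.Properties as All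
import Data.List.Relation.Unary.AllPairs.Properties as AllPairs
import Data.List.Relation.Unary.Unique.Propositional.Properties as Unique
open import Data.List.Relation.Unary.Any using (here; there; index; _─_)
open import Data.List.Relation.Unary.AllPairs as AllPairs using (AllPairs; []; _∷_)
open import Data.List.Relation.Unary.Unique.Propositional using (Unique)
open import Data.List.Membership.Propositional using (_∈_; find)
open import Data.List.Membership.Propositional.Properties
  using (∈-++⁺ˡ; ∈-++⁺ʳ; ∈-++⁻; ∈-map⁺; ∈-map⁻; ∈-allFin; ∈-filter⁺)
open import Relation.Binary.PropositionalEquality hiding ([_])
open import Relation.Nullary using (¬_; Dec; yes; no; does; contradiction)
open import Relation.Nullary.Decidable using (map′; _⊎-dec_; dec-true; dec-false)

module _ {A B : Set} where

  ∈-─ : ∀ {x y} {ys : List B} (p : x ∈ ys) → y ∈ ys → y ≢ x → y ∈ (ys ─ p)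
  ∈-─ (here refl) (here refl) y≢x = contradiction refl y≢x
  ∈-─ (here refl) (there q)   _   = q
  ∈-─ (there p)   (here refl) _   = here refl
  ∈-─ (there p)   (there q)   y≢x = there (∈-─ p q y≢x)

  distinctRepresentatives⇒length≤ :
    (P : A → B → Set) {xs : List A} (ys : List B) →
    AllPairs (λ a a′ → ∀ {b} → P a b → P a′ b → ⊥) xs →
    All (λ a → ∃[ b ] b ∈ ys × P a b) xs → length xs ≤ length ys
  distinctRepresentatives⇒length≤ P ys [] [] = z≤n
  distinctRepresentatives⇒length≤ P ys (apart ∷ apartᵣ) ((b , b∈ys , pab) ∷ reps) =
    subst (suc _ ≤_) (sym (length-removeAt′ ys (index b∈ys)))
      (s≤s (distinctRepresentatives⇒length≤ P (ys ─ b∈ys) apartᵣ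
        (All.zipWith (λ (apart′ , (b′ , b′∈ys , pa′b′)) →
           b′ , ∈-─ b∈ys b′∈ys (λ { refl → apart′ pab pa′b′ }) , pa′b′)
          (apart , reps))))

allPairs-restrict : ∀ {A : Set} {P : A → Set} {R : A → A → Set} {xs : List A} →
                    All P xs → AllPairs (λ x y → P x → P y → R x y) xs → AllPairs R xs
allPairs-restrict []         []         = []
allPairs-restrict (px ∷ pxs) (rs ∷ rss) =
  All.zipWith (λ (py , r) → r px py) (pxs , rs) ∷ allPairs-restrict pxs rss

module _ {n : ℕ} where

  toℕ-even : (j : Fin n) → toℕ (even j) ≡ 2 * toℕ j
  toℕ-even j = trans (Fin.toℕ-combine j zero) (ℕ.+-identityʳ _)

  toℕ-odd : (j : Fin n) → toℕ (odd j) ≡ suc (2 * toℕ j)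
  toℕ-odd j = trans (Fin.toℕ-combine j (suc zero)) (ℕ.+-comm _ 1)

  inject₁-odd : (j : Fin n) → inject₁ (odd j) ≡ suc (even j)
  inject₁-odd j = Fin.toℕ-injective (begin
    toℕ (inject₁ (odd j)) ≡⟨ Fin.toℕ-inject₁ (odd j) ⟩
    toℕ (odd j)           ≡⟨ toℕ-odd j ⟩
    suc (2 * toℕ j)       ≡⟨ cong suc (toℕ-even j) ⟨
    suc (toℕ (even j))    ∎)
    where open ≡-Reasoning

  even-injective : {j l : Fin n} → even j ≡ even l → j ≡ l
  even-injective {j} {l} = Fin.combine-injectiveˡ j zero l zero

  odd-injective : {j l : Fin n} → odd j ≡ odd l → j ≡ l
  odd-injective {j} {l} = Fin.combine-injectiveˡ j (suc zero) l (suc zero)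

  even≢odd : (j l : Fin n) → even j ≢ odd l
  even≢odd j l eq = ℕ.even≢odd (toℕ j) (toℕ l)
    (trans (sym (toℕ-even j)) (trans (cong toℕ eq) (toℕ-odd l)))

  data Parity : Fin (n * 2) → Set where
    evenᵖ : (j : Fin n) → Parity (even j)
    oddᵖ  : (j : Fin n) → Parity (odd j)

  parity : (i : Fin (n * 2)) → Parity i
  parity i = subst Parity (Fin.combine-remQuot {n} 2 i) (view (remQuot {n} 2 i))
    where
    view : (p : Fin n × Fin 2) → Parity (uncurry combine p)
    view (j , zero)     = evenᵖ j
    view (j , suc zero) = oddᵖ j

  inject₁≡suc-even⇒odd : ∀ {i : Fin (n * 2)} j → inject₁ i ≡ suc (even j) → i ≡ odd j
  inject₁≡suc-even⇒odd j eq = Fin.inject₁-injective (trans eq (sym (inject₁-odd j)))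

  inject₁≡suc-odd⇒even : ∀ {i : Fin (n * 2)} j → inject₁ i ≡ suc (odd j) → Σ (Fin n) λ l → i ≡ even l
  inject₁≡suc-odd⇒even {i} j eq with parity i
  ... | evenᵖ l = l , refl
  ... | oddᵖ l  = contradiction (begin
      suc (2 * toℕ l)          ≡⟨ toℕ-odd l ⟨
      toℕ (odd l)              ≡⟨ Fin.toℕ-inject₁ (odd l) ⟨
      toℕ (inject₁ (odd l))    ≡⟨ cong toℕ eq ⟩
      suc (toℕ (odd j))        ≡⟨ cong suc (toℕ-odd j) ⟩
      suc (suc (2 * toℕ j))    ≡⟨ ℕ.*-suc 2 (toℕ j) ⟨
      2 * suc (toℕ j)          ∎) (ℕ.even≢odd (suc (toℕ j)) (toℕ l) ∘ sym)
    where open ≡-Reasoning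

  inject₁≡zero⇒even : ∀ {i : Fin (n * 2)} → inject₁ i ≡ zero → Σ (Fin n) λ l → i ≡ even l
  inject₁≡zero⇒even {i} eq with parity i
  ... | evenᵖ l = l , refl
  ... | oddᵖ l  = contradiction (trans (sym (toℕ-odd l)) (trans (sym (Fin.toℕ-inject₁ (odd l))) (cong toℕ eq))) λ ()

inject₁≢suc : ∀ {m} (i : Fin m) → inject₁ i ≢ suc i
inject₁≢suc i eq = ℕ.1+n≢n (sym (trans (sym (Fin.toℕ-inject₁ i)) (cong toℕ eq)))

module _ {n : ℕ} where

  private
    Code : Set
    Code = Fin (n * 2) ⊎ Fin (n * 2) ⊎ Fin (suc (n * 2)) ⊎ Fin (n * 2) ⊎ Fin (n * 2) ⊎ Fin n ⊎ Fin n

    encode : Edge n → Code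
    encode (uu i) = inj₁ i
    encode (vv i) = inj₂ (inj₁ i)
    encode (uv c) = inj₂ (inj₂ (inj₁ c))
    encode (wu i) = inj₂ (inj₂ (inj₂ (inj₁ i)))
    encode (vz i) = inj₂ (inj₂ (inj₂ (inj₂ (inj₁ i))))
    encode (ww j) = inj₂ (inj₂ (inj₂ (inj₂ (inj₂ (inj₁ j)))))
    encode (zz j) = inj₂ (inj₂ (inj₂ (inj₂ (inj₂ (inj₂ j)))))

    decode : Code → Edge n
    decode (inj₁ i)                                        = uu i
    decode (inj₂ (inj₁ i))                                 = vv i
    decode (inj₂ (inj₂ (inj₁ c)))                          = uv c
    decode (inj₂ (inj₂ (inj₂ (inj₁ i))))                   = wu i
    decode (inj₂ (inj₂ (inj₂ (inj₂ (inj₁ i)))))            = vz i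
    decode (inj₂ (inj₂ (inj₂ (inj₂ (inj₂ (inj₁ j))))))     = ww j
    decode (inj₂ (inj₂ (inj₂ (inj₂ (inj₂ (inj₂ j))))))     = zz j

    decode-encode : (e : Edge n) → decode (encode e) ≡ e
    decode-encode (uu _) = refl
    decode-encode (vv _) = refl
    decode-encode (uv _) = refl
    decode-encode (wu _) = refl
    decode-encode (vz _) = refl
    decode-encode (ww _) = refl
    decode-encode (zz _) = refl

    _≟ᶜ_ : (a b : Code) → Dec (a ≡ b)
    _≟ᶜ_ = Sum.≡-dec Fin._≟_ (Sum.≡-dec Fin._≟_ (Sum.≡-dec Fin._≟_ (Sum.≡-dec Fin._≟_
             (Sum.≡-dec Fin._≟_ (Sum.≡-dec Fin._≟_ Fin._≟_)))))

  infix 4 _≟ᴱ_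
  _≟ᴱ_ : (a b : Edge n) → Dec (a ≡ b)
  a ≟ᴱ b = map′ injective (cong encode) (encode a ≟ᶜ encode b)
    where
    injective : encode a ≡ encode b → a ≡ b
    injective eq = trans (sym (decode-encode a)) (trans (cong decode eq) (decode-encode b))

  ∂₁ ∂₂ ∂₃ ∂₄ : Face n → Edge n
  ∂₁ f = proj₁ (boundary f)
  ∂₂ f = proj₁ (proj₂ (boundary f))
  ∂₃ f = proj₁ (proj₂ (proj₂ (boundary f)))
  ∂₄ f = proj₂ (proj₂ (proj₂ (boundary f)))

  infix 4 _∈∂_ _∈∂?_
  _∈∂_ : Edge n → Face n → Set
  e ∈∂ f = e ≡ ∂₁ f ⊎ e ≡ ∂₂ f ⊎ e ≡ ∂₃ f ⊎ e ≡ ∂₄ f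

  _∈∂?_ : (e : Edge n) (f : Face n) → Dec (e ∈∂ f)
  e ∈∂? f = (e ≟ᴱ ∂₁ f) ⊎-dec (e ≟ᴱ ∂₂ f) ⊎-dec (e ≟ᴱ ∂₃ f) ⊎-dec (e ≟ᴱ ∂₄ f)

  Apart : Edge n → Edge n → Set
  Apart a b = ∀ x → Incident a x → Incident b x → ⊥

  ∈∂⇒onFace : (f : Face n) {e : Edge n} {x : Vtx n} → e ∈∂ f → Incident e x → OnFace f x
  ∈∂⇒onFace (mid _) (inj₁ refl)                 inc = inj₁ inc
  ∈∂⇒onFace (mid _) (inj₂ (inj₁ refl))          inc = inj₂ (inj₁ inc)
  ∈∂⇒onFace (mid _) (inj₂ (inj₂ (inj₁ refl)))   inc = inj₂ (inj₂ (inj₁ inc))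
  ∈∂⇒onFace (mid _) (inj₂ (inj₂ (inj₂ refl)))   inc = inj₂ (inj₂ (inj₂ inc))
  ∈∂⇒onFace (top _) (inj₁ refl)                 inc = inj₁ inc
  ∈∂⇒onFace (top _) (inj₂ (inj₁ refl))          inc = inj₂ (inj₁ inc)
  ∈∂⇒onFace (top _) (inj₂ (inj₂ (inj₁ refl)))   inc = inj₂ (inj₂ (inj₁ inc))
  ∈∂⇒onFace (top _) (inj₂ (inj₂ (inj₂ refl)))   inc = inj₂ (inj₂ (inj₂ inc))
  ∈∂⇒onFace (bot _) (inj₁ refl)                 inc = inj₁ inc
  ∈∂⇒onFace (bot _) (inj₂ (inj₁ refl))          inc = inj₂ (inj₁ inc)
  ∈∂⇒onFace (bot _) (inj₂ (inj₂ (inj₁ refl)))   inc = inj₂ (inj₂ (inj₁ inc))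
  ∈∂⇒onFace (bot _) (inj₂ (inj₂ (inj₂ refl)))   inc = inj₂ (inj₂ (inj₂ inc))

  ∂₁-∂₃-apart : (f : Face n) → Apart (∂₁ f) (∂₃ f)
  ∂₁-∂₃-apart (mid i) x (inj₁ refl) (inj₁ ())
  ∂₁-∂₃-apart (mid i) x (inj₁ refl) (inj₂ ())
  ∂₁-∂₃-apart (mid i) x (inj₂ refl) (inj₁ ())
  ∂₁-∂₃-apart (mid i) x (inj₂ refl) (inj₂ ())
  ∂₁-∂₃-apart (top j) x (inj₁ refl) (inj₁ ())
  ∂₁-∂₃-apart (top j) x (inj₁ refl) (inj₂ ())
  ∂₁-∂₃-apart (top j) x (inj₂ refl) (inj₁ ())
  ∂₁-∂₃-apart (top j) x (inj₂ refl) (inj₂ ())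
  ∂₁-∂₃-apart (bot j) x (inj₁ refl) (inj₁ ())
  ∂₁-∂₃-apart (bot j) x (inj₁ refl) (inj₂ ())
  ∂₁-∂₃-apart (bot j) x (inj₂ refl) (inj₁ ())
  ∂₁-∂₃-apart (bot j) x (inj₂ refl) (inj₂ ())

  ∂₂-∂₄-apart : (f : Face n) → Apart (∂₂ f) (∂₄ f)
  ∂₂-∂₄-apart (mid i) x (inj₁ refl) (inj₁ eq) = inject₁≢suc i (cong (λ { (U c) → c ; _ → zero }) eq)
  ∂₂-∂₄-apart (mid i) x (inj₁ refl) (inj₂ ())
  ∂₂-∂₄-apart (mid i) x (inj₂ refl) (inj₁ ())
  ∂₂-∂₄-apart (mid i) x (inj₂ refl) (inj₂ eq) = inject₁≢suc i (cong (λ { (V c) → c ; _ → zero }) eq)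
  ∂₂-∂₄-apart (top j) x (inj₁ refl) (inj₁ eq) = even≢odd j j (cong (λ { (W c) → c ; _ → even j }) eq)
  ∂₂-∂₄-apart (top j) x (inj₁ refl) (inj₂ ())
  ∂₂-∂₄-apart (top j) x (inj₂ refl) (inj₁ ())
  ∂₂-∂₄-apart (top j) x (inj₂ refl) (inj₂ eq) =
    even≢odd j j (Fin.suc-injective (cong (λ { (U c) → c ; _ → suc (even j) }) eq))
  ∂₂-∂₄-apart (bot j) x (inj₁ refl) (inj₁ eq) =
    even≢odd j j (Fin.suc-injective (cong (λ { (V c) → c ; _ → suc (even j) }) eq))
  ∂₂-∂₄-apart (bot j) x (inj₁ refl) (inj₂ ())
  ∂₂-∂₄-apart (bot j) x (inj₂ refl) (inj₁ ())
  ∂₂-∂₄-apart (bot j) x (inj₂ refl) (inj₂ eq) = even≢odd j j (cong (λ { (Z c) → c ; _ → even j }) eq)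

  onFace-corner : (f : Face n) {x : Vtx n} → OnFace f x →
    (Incident (∂₁ f) x ⊎ Incident (∂₃ f) x) × (Incident (∂₂ f) x ⊎ Incident (∂₄ f) x)
  onFace-corner (mid i) (inj₁ (inj₁ refl)) = inj₁ (inj₁ refl) , inj₂ (inj₁ refl)
  onFace-corner (mid i) (inj₁ (inj₂ refl)) = inj₁ (inj₂ refl) , inj₁ (inj₁ refl)
  onFace-corner (mid i) (inj₂ (inj₁ (inj₁ refl))) = inj₁ (inj₂ refl) , inj₁ (inj₁ refl)
  onFace-corner (mid i) (inj₂ (inj₁ (inj₂ refl))) = inj₂ (inj₂ refl) , inj₁ (inj₂ refl)
  onFace-corner (mid i) (inj₂ (inj₂ (inj₁ (inj₁ refl)))) = inj₂ (inj₁ refl) , inj₂ (inj₂ refl)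
  onFace-corner (mid i) (inj₂ (inj₂ (inj₁ (inj₂ refl)))) = inj₂ (inj₂ refl) , inj₁ (inj₂ refl)
  onFace-corner (mid i) (inj₂ (inj₂ (inj₂ (inj₁ refl)))) = inj₁ (inj₁ refl) , inj₂ (inj₁ refl)
  onFace-corner (mid i) (inj₂ (inj₂ (inj₂ (inj₂ refl)))) = inj₂ (inj₁ refl) , inj₂ (inj₂ refl)
  onFace-corner (top j) (inj₁ (inj₁ refl)) = inj₁ (inj₁ refl) , inj₂ (inj₁ refl)
  onFace-corner (top j) (inj₁ (inj₂ refl)) = inj₁ (inj₂ refl) , inj₁ (inj₁ refl)
  onFace-corner (top j) (inj₂ (inj₁ (inj₁ refl))) = inj₁ (inj₂ refl) , inj₁ (inj₁ refl)
  onFace-corner (top j) (inj₂ (inj₁ (inj₂ refl))) = inj₂ (inj₂ refl) , inj₁ (inj₂ refl)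
  onFace-corner (top j) (inj₂ (inj₂ (inj₁ (inj₁ refl)))) = inj₂ (inj₁ refl) , inj₂ (inj₂ (cong U (sym (inject₁-odd j))))
  onFace-corner (top j) (inj₂ (inj₂ (inj₁ (inj₂ refl)))) = inj₂ (inj₂ refl) , inj₁ (inj₂ refl)
  onFace-corner (top j) (inj₂ (inj₂ (inj₂ (inj₁ refl)))) = inj₁ (inj₁ refl) , inj₂ (inj₁ refl)
  onFace-corner (top j) (inj₂ (inj₂ (inj₂ (inj₂ refl)))) = inj₂ (inj₁ (cong U (inject₁-odd j))) , inj₂ (inj₂ refl)
  onFace-corner (bot j) (inj₁ (inj₁ refl)) = inj₁ (inj₁ refl) , inj₂ (inj₂ refl)
  onFace-corner (bot j) (inj₁ (inj₂ refl)) = inj₁ (inj₂ refl) , inj₁ (inj₂ refl)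
  onFace-corner (bot j) (inj₂ (inj₁ (inj₁ refl))) = inj₂ (inj₂ refl) , inj₁ (inj₁ refl)
  onFace-corner (bot j) (inj₂ (inj₁ (inj₂ refl))) = inj₁ (inj₂ refl) , inj₁ (inj₂ refl)
  onFace-corner (bot j) (inj₂ (inj₂ (inj₁ (inj₁ refl)))) = inj₂ (inj₁ refl) , inj₂ (inj₁ (cong V (sym (inject₁-odd j))))
  onFace-corner (bot j) (inj₂ (inj₂ (inj₁ (inj₂ refl)))) = inj₂ (inj₂ refl) , inj₁ (inj₁ refl)
  onFace-corner (bot j) (inj₂ (inj₂ (inj₂ (inj₁ refl)))) = inj₂ (inj₁ (cong V (inject₁-odd j))) , inj₂ (inj₁ refl)
  onFace-corner (bot j) (inj₂ (inj₂ (inj₂ (inj₂ refl)))) = inj₁ (inj₁ refl) , inj₂ (inj₂ refl)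

  data ∂-View : Edge n → Face n → Set where
    uu-mid  : ∀ i → ∂-View (uu i) (mid i)
    vv-mid  : ∀ i → ∂-View (vv i) (mid i)
    uvˡ-mid : ∀ {c} i → inject₁ i ≡ c → ∂-View (uv c) (mid i)
    uvʳ-mid : ∀ {c} i → suc i ≡ c → ∂-View (uv c) (mid i)
    ww-top  : ∀ j → ∂-View (ww j) (top j)
    uu-top  : ∀ {i} j → odd j ≡ i → ∂-View (uu i) (top j)
    wuˡ-top : ∀ {i} j → even j ≡ i → ∂-View (wu i) (top j)
    wuʳ-top : ∀ {i} j → odd j ≡ i → ∂-View (wu i) (top j)
    zz-bot  : ∀ j → ∂-View (zz j) (bot j)
    vv-bot  : ∀ {i} j → odd j ≡ i → ∂-View (vv i) (bot j)
    vzˡ-bot : ∀ {i} j → even j ≡ i → ∂-View (vz i) (bot j)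
    vzʳ-bot : ∀ {i} j → odd j ≡ i → ∂-View (vz i) (bot j)

  ∂-view : (f : Face n) {e : Edge n} → e ∈∂ f → ∂-View e f
  ∂-view (mid i) (inj₁ refl)               = uu-mid i
  ∂-view (mid i) (inj₂ (inj₁ refl))        = uvʳ-mid i refl
  ∂-view (mid i) (inj₂ (inj₂ (inj₁ refl))) = vv-mid i
  ∂-view (mid i) (inj₂ (inj₂ (inj₂ refl))) = uvˡ-mid i refl
  ∂-view (top j) (inj₁ refl)               = ww-top j
  ∂-view (top j) (inj₂ (inj₁ refl))        = wuʳ-top j refl
  ∂-view (top j) (inj₂ (inj₂ (inj₁ refl))) = uu-top j refl
  ∂-view (top j) (inj₂ (inj₂ (inj₂ refl))) = wuˡ-top j refl
  ∂-view (bot j) (inj₁ refl)               = zz-bot j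
  ∂-view (bot j) (inj₂ (inj₁ refl))        = vzʳ-bot j refl
  ∂-view (bot j) (inj₂ (inj₂ (inj₁ refl))) = vv-bot j refl
  ∂-view (bot j) (inj₂ (inj₂ (inj₂ refl))) = vzˡ-bot j refl

  data Adjacent : Face n → Face n → Set where
    mid-mid : ∀ {i k} → suc i ≡ inject₁ k → Adjacent (mid i) (mid k)
    top-mid : ∀ {j i} → odd j ≡ i → Adjacent (top j) (mid i)
    bot-mid : ∀ {j i} → odd j ≡ i → Adjacent (bot j) (mid i)

  common-∂⇒adjacent : (f g : Face n) {e : Edge n} → e ∈∂ f → e ∈∂ g →
                      f ≡ g ⊎ Adjacent f g ⊎ Adjacent g f
  common-∂⇒adjacent f g e∈∂f e∈∂g = views (∂-view f e∈∂f) (∂-view g e∈∂g)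
    where
    views : ∀ {e f g} → ∂-View e f → ∂-View e g → f ≡ g ⊎ Adjacent f g ⊎ Adjacent g f
    views (uu-mid i)    (uu-mid i)    = inj₁ refl
    views (uu-mid i)    (uu-top l q)  = inj₂ (inj₂ (top-mid q))
    views (uu-top j p)  (uu-mid i)    = inj₂ (inj₁ (top-mid p))
    views (uu-top j p)  (uu-top l q)  = inj₁ (cong top (odd-injective (trans p (sym q))))
    views (vv-mid i)    (vv-mid i)    = inj₁ refl
    views (vv-mid i)    (vv-bot l q)  = inj₂ (inj₂ (bot-mid q))
    views (vv-bot j p)  (vv-mid i)    = inj₂ (inj₁ (bot-mid p))
    views (vv-bot j p)  (vv-bot l q)  = inj₁ (cong bot (odd-injective (trans p (sym q))))
    views (uvˡ-mid i p) (uvˡ-mid k q) = inj₁ (cong mid (Fin.inject₁-injective (trans p (sym q))))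
    views (uvˡ-mid i p) (uvʳ-mid k q) = inj₂ (inj₂ (mid-mid (trans q (sym p))))
    views (uvʳ-mid i p) (uvˡ-mid k q) = inj₂ (inj₁ (mid-mid (trans p (sym q))))
    views (uvʳ-mid i p) (uvʳ-mid k q) = inj₁ (cong mid (Fin.suc-injective (trans p (sym q))))
    views (ww-top j)    (ww-top j)    = inj₁ refl
    views (wuˡ-top j p) (wuˡ-top l q) = inj₁ (cong top (even-injective (trans p (sym q))))
    views (wuˡ-top j p) (wuʳ-top l q) = contradiction (trans p (sym q)) (even≢odd j l)
    views (wuʳ-top j p) (wuˡ-top l q) = contradiction (trans q (sym p)) (even≢odd l j)
    views (wuʳ-top j p) (wuʳ-top l q) = inj₁ (cong top (odd-injective (trans p (sym q))))
    views (zz-bot j)    (zz-bot j)    = inj₁ refl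
    views (vzˡ-bot j p) (vzˡ-bot l q) = inj₁ (cong bot (even-injective (trans p (sym q))))
    views (vzˡ-bot j p) (vzʳ-bot l q) = contradiction (trans p (sym q)) (even≢odd j l)
    views (vzʳ-bot j p) (vzˡ-bot l q) = contradiction (trans q (sym p)) (even≢odd l j)
    views (vzʳ-bot j p) (vzʳ-bot l q) = inj₁ (cong bot (odd-injective (trans p (sym q))))

  data AtU (c : Fin (suc (n * 2))) : Edge n → Set where
    left  : ∀ i → suc i ≡ c → AtU c (uu i)
    right : ∀ i → inject₁ i ≡ c → AtU c (uu i)
    down  : AtU c (uv c)
    up    : ∀ i → suc i ≡ c → AtU c (wu i)

  data AtV (c : Fin (suc (n * 2))) : Edge n → Set where
    left  : ∀ i → suc i ≡ c → AtV c (vv i)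
    right : ∀ i → inject₁ i ≡ c → AtV c (vv i)
    up    : AtV c (uv c)
    down  : ∀ i → suc i ≡ c → AtV c (vz i)

  data AtW (k : Fin (n * 2)) : Edge n → Set where
    right : ∀ j → even j ≡ k → AtW k (ww j)
    left  : ∀ j → odd j ≡ k → AtW k (ww j)
    down  : AtW k (wu k)

  data AtZ (k : Fin (n * 2)) : Edge n → Set where
    right : ∀ j → even j ≡ k → AtZ k (zz j)
    left  : ∀ j → odd j ≡ k → AtZ k (zz j)
    up    : AtZ k (vz k)

  private
    U-injective : ∀ {a b} → U {n} a ≡ U b → a ≡ b
    U-injective refl = refl
    V-injective : ∀ {a b} → V {n} a ≡ V b → a ≡ b
    V-injective refl = refl
    W-injective : ∀ {a b} → W {n} a ≡ W b → a ≡ b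
    W-injective refl = refl
    Z-injective : ∀ {a b} → Z {n} a ≡ Z b → a ≡ b
    Z-injective refl = refl

  atU : ∀ {c e} → Incident e (U c) → AtU c e
  atU {e = uu i} (inj₁ eq)   = right i (U-injective eq)
  atU {e = uu i} (inj₂ eq)   = left i (U-injective eq)
  atU {e = uv _} (inj₁ refl) = down
  atU {e = wu i} (inj₂ eq)   = up i (U-injective eq)
  atU {e = uv _} (inj₂ ())
  atU {e = wu _} (inj₁ ())
  atU {e = vv _} (inj₁ ())
  atU {e = vv _} (inj₂ ())
  atU {e = vz _} (inj₁ ())
  atU {e = vz _} (inj₂ ())
  atU {e = ww _} (inj₁ ())
  atU {e = ww _} (inj₂ ())
  atU {e = zz _} (inj₁ ())
  atU {e = zz _} (inj₂ ())

  atV : ∀ {c e} → Incident e (V c) → AtV c e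
  atV {e = vv i} (inj₁ eq)   = right i (V-injective eq)
  atV {e = vv i} (inj₂ eq)   = left i (V-injective eq)
  atV {e = uv _} (inj₂ refl) = up
  atV {e = vz i} (inj₁ eq)   = down i (V-injective eq)
  atV {e = uv _} (inj₁ ())
  atV {e = vz _} (inj₂ ())
  atV {e = uu _} (inj₁ ())
  atV {e = uu _} (inj₂ ())
  atV {e = wu _} (inj₁ ())
  atV {e = wu _} (inj₂ ())
  atV {e = ww _} (inj₁ ())
  atV {e = ww _} (inj₂ ())
  atV {e = zz _} (inj₁ ())
  atV {e = zz _} (inj₂ ())

  atW : ∀ {k e} → Incident e (W k) → AtW k e
  atW {e = ww j} (inj₁ eq)   = right j (W-injective eq)
  atW {e = ww j} (inj₂ eq)   = left j (W-injective eq)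
  atW {e = wu _} (inj₁ refl) = down
  atW {e = wu _} (inj₂ ())
  atW {e = uu _} (inj₁ ())
  atW {e = uu _} (inj₂ ())
  atW {e = vv _} (inj₁ ())
  atW {e = vv _} (inj₂ ())
  atW {e = uv _} (inj₁ ())
  atW {e = uv _} (inj₂ ())
  atW {e = vz _} (inj₁ ())
  atW {e = vz _} (inj₂ ())
  atW {e = zz _} (inj₁ ())
  atW {e = zz _} (inj₂ ())

  atZ : ∀ {k e} → Incident e (Z k) → AtZ k e
  atZ {e = zz j} (inj₁ eq)   = right j (Z-injective eq)
  atZ {e = zz j} (inj₂ eq)   = left j (Z-injective eq)
  atZ {e = vz _} (inj₂ refl) = up
  atZ {e = vz _} (inj₁ ())
  atZ {e = uu _} (inj₁ ())
  atZ {e = uu _} (inj₂ ())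
  atZ {e = vv _} (inj₁ ())
  atZ {e = vv _} (inj₂ ())
  atZ {e = uv _} (inj₁ ())
  atZ {e = uv _} (inj₂ ())
  atZ {e = wu _} (inj₁ ())
  atZ {e = wu _} (inj₂ ())
  atZ {e = ww _} (inj₁ ())
  atZ {e = ww _} (inj₂ ())

≡true⇒≢false : ∀ {b} → b ≡ true → b ≢ false
≡true⇒≢false refl ()

Alternates : Bool → Bool → Bool → Bool → Set
Alternates a b c d = (a ≡ true × b ≡ false × c ≡ true × d ≡ false) ⊎
                     (a ≡ false × b ≡ true × c ≡ false × d ≡ true)

alternates : Bool → Bool → Bool → Bool → Bool
alternates true  false true  false = true
alternates false true  false true  = true
alternates _     _     _     _     = false

alternates-sound : ∀ a b c d → alternates a b c d ≡ true → Alternates a b c d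
alternates-sound true  false true  false _ = inj₁ (refl , refl , refl , refl)
alternates-sound false true  false true  _ = inj₂ (refl , refl , refl , refl)
alternates-sound true  true  _     _     ()
alternates-sound true  false false _     ()
alternates-sound true  false true  true  ()
alternates-sound false false _     _     ()
alternates-sound false true  true  _     ()
alternates-sound false true  false false ()

alternates-complete : ∀ {a b c d} → Alternates a b c d → alternates a b c d ≡ true
alternates-complete (inj₁ (refl , refl , refl , refl)) = refl
alternates-complete (inj₂ (refl , refl , refl , refl)) = refl

perfectMatching-unique : ∀ {n} {M : EdgeSet n} → IsPerfectMatching M → ∀ {a b x} →
                         M a ≡ true → M b ≡ true → Incident a x → Incident b x → a ≡ b
perfectMatching-unique pm {a} {b} {x} Ma Mb a∋x b∋x =
  let _ , _ , _ , unique = pm x in trans (unique a Ma a∋x) (sym (unique b Mb b∋x))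

module _ {n : ℕ} (M : EdgeSet n) where

  AlternatingBoundary : Face n → Set
  AlternatingBoundary f = Alternates (M (∂₁ f)) (M (∂₂ f)) (M (∂₃ f)) (M (∂₄ f))

  alternating⇒alternatingBoundary : (f : Face n) → Alternating M f → AlternatingBoundary f
  alternating⇒alternatingBoundary (mid _) alt = alt
  alternating⇒alternatingBoundary (top _) alt = alt
  alternating⇒alternatingBoundary (bot _) alt = alt

  alternatingBoundary⇒alternating : (f : Face n) → AlternatingBoundary f → Alternating M f
  alternatingBoundary⇒alternating (mid _) alt = alt
  alternatingBoundary⇒alternating (top _) alt = alt
  alternatingBoundary⇒alternating (bot _) alt = alt

  record Square (f : Face n) : Set where
    field
      a₁ a₂ b₁ b₂ : Edge n
      roles       : ∀ {e} → e ∈∂ f → e ≡ a₁ ⊎ e ≡ a₂ ⊎ e ≡ b₁ ⊎ e ≡ b₂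
      a₁∈∂ : a₁ ∈∂ f
      a₂∈∂ : a₂ ∈∂ f
      b₁∈∂ : b₁ ∈∂ f
      b₂∈∂ : b₂ ∈∂ f
      Ma₁ : M a₁ ≡ true
      Ma₂ : M a₂ ≡ true
      Mb₁ : M b₁ ≡ false
      Mb₂ : M b₂ ≡ false
      b-apart : Apart b₁ b₂
      corner  : ∀ {x} → OnFace f x → (Incident a₁ x ⊎ Incident a₂ x) × (Incident b₁ x ⊎ Incident b₂ x)

  alternating⇒square : (f : Face n) → Alternating M f → Square f
  alternating⇒square f alt with alternating⇒alternatingBoundary f alt
  ... | inj₁ (M∂₁ , M∂₂ , M∂₃ , M∂₄) = record
    { a₁ = ∂₁ f ; a₂ = ∂₃ f ; b₁ = ∂₂ f ; b₂ = ∂₄ f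
    ; roles = λ { (inj₁ p) → inj₁ p ; (inj₂ (inj₁ p)) → inj₂ (inj₂ (inj₁ p))
                ; (inj₂ (inj₂ (inj₁ p))) → inj₂ (inj₁ p) ; (inj₂ (inj₂ (inj₂ p))) → inj₂ (inj₂ (inj₂ p)) }
    ; a₁∈∂ = inj₁ refl ; a₂∈∂ = inj₂ (inj₂ (inj₁ refl))
    ; b₁∈∂ = inj₂ (inj₁ refl) ; b₂∈∂ = inj₂ (inj₂ (inj₂ refl))
    ; Ma₁ = M∂₁ ; Ma₂ = M∂₃ ; Mb₁ = M∂₂ ; Mb₂ = M∂₄
    ; b-apart = ∂₂-∂₄-apart f
    ; corner = onFace-corner f
    }
  ... | inj₂ (M∂₁ , M∂₂ , M∂₃ , M∂₄) = record
    { a₁ = ∂₂ f ; a₂ = ∂₄ f ; b₁ = ∂₁ f ; b₂ = ∂₃ f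
    ; roles = λ { (inj₁ p) → inj₂ (inj₂ (inj₁ p)) ; (inj₂ (inj₁ p)) → inj₁ p
                ; (inj₂ (inj₂ (inj₁ p))) → inj₂ (inj₂ (inj₂ p)) ; (inj₂ (inj₂ (inj₂ p))) → inj₂ (inj₁ p) }
    ; a₁∈∂ = inj₂ (inj₁ refl) ; a₂∈∂ = inj₂ (inj₂ (inj₂ refl))
    ; b₁∈∂ = inj₁ refl ; b₂∈∂ = inj₂ (inj₂ (inj₁ refl))
    ; Ma₁ = M∂₂ ; Ma₂ = M∂₄ ; Mb₁ = M∂₁ ; Mb₂ = M∂₃
    ; b-apart = ∂₁-∂₃-apart f
    ; corner = λ on → let a , b = onFace-corner f on in b , a
    }

  alternating⇒M-edge-at-corner : (f : Face n) → Alternating M f → ∀ {x} → OnFace f x →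
                                 ∃[ e ] e ∈∂ f × M e ≡ true × Incident e x
  alternating⇒M-edge-at-corner f alt on = [ at a₁∈∂ Ma₁ , at a₂∈∂ Ma₂ ] (proj₁ (corner on))
    where
    open Square (alternating⇒square f alt)
    at : ∀ {e x} → e ∈∂ f → M e ≡ true → Incident e x → ∃[ e′ ] e′ ∈∂ f × M e′ ≡ true × Incident e′ x
    at e∈∂ Me e∋x = _ , e∈∂ , Me , e∋x

  flip : Face n → EdgeSet n
  flip f e = if does (e ∈∂? f) then not (M e) else M e

  flip-∈∂ : ∀ f {e} → e ∈∂ f → flip f e ≡ not (M e)
  flip-∈∂ f {e} e∈∂ = cong (λ b → if b then not (M e) else M e) (dec-true (e ∈∂? f) e∈∂)

  flip-∉∂ : ∀ f {e} → ¬ e ∈∂ f → flip f e ≡ M e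
  flip-∉∂ f {e} e∉∂ = cong (λ b → if b then not (M e) else M e) (dec-false (e ∈∂? f) e∉∂)

  module _ (pm : IsPerfectMatching M) (f : Face n) (alt : Alternating M f) where
    open Square (alternating⇒square f alt)

    private
      flipped-b : ∀ {e} → e ∈∂ f → flip f e ≡ true → e ≡ b₁ ⊎ e ≡ b₂
      flipped-b e∈∂ flip-e with roles e∈∂
      ... | inj₁ refl        = ⊥-elim (≡true⇒≢false flip-e (trans (flip-∈∂ f e∈∂) (cong not Ma₁)))
      ... | inj₂ (inj₁ refl) = ⊥-elim (≡true⇒≢false flip-e (trans (flip-∈∂ f e∈∂) (cong not Ma₂)))
      ... | inj₂ (inj₂ b)    = b

    -- Off f the M-edge survives; at a corner of f the M-edge is some aᵢ,
    -- and it is replaced by the unique bⱼ through that corner.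
    flip-isPerfectMatching : IsPerfectMatching (flip f)
    flip-isPerfectMatching x with pm x
    ... | m , Mm , m∋x , m-unique with m ∈∂? f
    ...   | no m∉∂ = m , trans (flip-∉∂ f m∉∂) Mm , m∋x , unique
      where
      unique : ∀ e → flip f e ≡ true → Incident e x → e ≡ m
      unique e flip-e e∋x with e ∈∂? f
      ... | no e∉∂  = m-unique e (trans (sym (flip-∉∂ f e∉∂)) flip-e) e∋x
      ... | yes e∈∂ with proj₂ (alternating⇒M-edge-at-corner f alt (∈∂⇒onFace f e∈∂ e∋x))
      ...   | a∈∂ , Ma , a∋x = contradiction (subst (_∈∂ f) (m-unique _ Ma a∋x) a∈∂) m∉∂
    ...   | yes m∈∂ =
      [ replace b₁∈∂ Mb₁ (λ b₁∋x e∋x → [ id , (λ { refl → ⊥-elim (b-apart x b₁∋x e∋x) }) ])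
      , replace b₂∈∂ Mb₂ (λ b₂∋x e∋x → [ (λ { refl → ⊥-elim (b-apart x e∋x b₂∋x) }) , id ])
      ] (proj₂ (corner (∈∂⇒onFace f m∈∂ m∋x)))
      where
      flipped-∈∂ : ∀ {e} → flip f e ≡ true → Incident e x → e ∈∂ f
      flipped-∈∂ {e} flip-e e∋x with e ∈∂? f
      ... | yes e∈∂ = e∈∂
      ... | no e∉∂  = subst (_∈∂ f) (sym (m-unique e (trans (sym (flip-∉∂ f e∉∂)) flip-e) e∋x)) m∈∂

      replace : ∀ {b} → b ∈∂ f → M b ≡ false →
                (Incident b x → ∀ {e} → Incident e x → e ≡ b₁ ⊎ e ≡ b₂ → e ≡ b) → Incident b x →
                Σ (Edge n) λ e → (flip f e ≡ true) × Incident e x ×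
                  ((e′ : Edge n) → flip f e′ ≡ true → Incident e′ x → e′ ≡ e)
      replace {b} b∈∂ Mb only-b b∋x = b , trans (flip-∈∂ f b∈∂) (cong not Mb) , b∋x ,
        λ e flip-e e∋x → only-b b∋x e∋x (flipped-b (flipped-∈∂ flip-e e∋x) flip-e)

-- Lower bound: s(M) ≤ f(G_n, M)

module _ {n : ℕ} {M : EdgeSet n} (pm : IsPerfectMatching M) where

  forcingSet-meets-alternating : ∀ {S} → IsForcingSet M S → (f : Face n) → Alternating M f →
                                 ∃[ e ] e ∈ S × e ∈∂ f
  forcingSet-meets-alternating {S} (_ , S⊆M , forces) f alt =
    let s , s∈S , M′s≢true = find (¬All⇒Any¬ (λ e → flip M f e ≟ᴮ true) S S⊈M′)
    in s , s∈S , meets s∈S M′s≢true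
    where
    S⊈M′ : ¬ All (λ e → flip M f e ≡ true) S
    S⊈M′ S⊆M′ = not-¬ refl (trans (sym (forces (flip M f) (flip-isPerfectMatching M pm f alt) S⊆M′ (∂₁ f)))
                                  (flip-∈∂ M f (inj₁ refl)))

    meets : ∀ {s} → s ∈ S → flip M f s ≢ true → s ∈∂ f
    meets {s} s∈S M′s≢true with s ∈∂? f
    ... | yes s∈∂ = s∈∂
    ... | no s∉∂  = contradiction (trans (flip-∉∂ M f s∉∂) (All.lookup S⊆M s∈S)) M′s≢true

  resonant≤forcing : ∀ {S R} → IsForcingSet M S → IsResonantSet M R → length R ≤ length S
  resonant≤forcing {S} forcing (disjoint , alternating) =
    distinctRepresentatives⇒length≤ (λ f e → e ∈∂ f) S
      (AllPairs.map (λ {f} {g} f∩g=∅ {e} e∈∂f e∈∂g →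
                       f∩g=∅ _ (∈∂⇒onFace f e∈∂f (inj₁ refl)) (∈∂⇒onFace g e∈∂g (inj₁ refl)))
                    disjoint)
      (All.map (λ {f} → forcingSet-meets-alternating forcing f) alternating)

-- Greedy selection

greedy : (ℕ → Bool) → ℕ → Bool
greedy p zero    = p zero
greedy p (suc t) = p (suc t) ∧ not (greedy p t)

greedy⇒eligible : ∀ p t → greedy p t ≡ true → p t ≡ true
greedy⇒eligible p zero    g = g
greedy⇒eligible p (suc t) g = ∧-conicalˡ _ _ g

greedy⇒¬greedy-pred : ∀ p t → greedy p (suc t) ≡ true → greedy p t ≡ false
greedy⇒¬greedy-pred p t g with greedy p t | ∧-conicalʳ (p (suc t)) _ g
... | false | _  = refl
... | true  | ()

greedy-intro : ∀ p t → p (suc t) ≡ true → greedy p t ≡ false → greedy p (suc t) ≡ true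
greedy-intro p t eligible not-taken rewrite eligible | not-taken = refl

extend : ∀ {k} → (Fin k → Bool) → ℕ → Bool
extend {zero}  p _       = false
extend {suc k} p zero    = p zero
extend {suc k} p (suc t) = extend (λ i → p (suc i)) t

extend-toℕ : ∀ {k} (p : Fin k → Bool) (i : Fin k) → extend p (toℕ i) ≡ p i
extend-toℕ p zero    = refl
extend-toℕ p (suc i) = extend-toℕ (λ i → p (suc i)) i

module _ {n : ℕ} where

  atOdd : (Fin n → Bool) → Fin (n * 2) → Bool
  atOdd p i = select (remQuot {n} 2 i)
    where
    select : Fin n × Fin 2 → Bool
    select (j , zero)     = false
    select (j , suc zero) = p j

  atOdd-even : (p : Fin n → Bool) (j : Fin n) → atOdd p (even j) ≡ false
  atOdd-even p j rewrite Fin.remQuot-combine {k = 2} j zero = refl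

  atOdd-odd : (p : Fin n → Bool) (j : Fin n) → atOdd p (odd j) ≡ p j
  atOdd-odd p j rewrite Fin.remQuot-combine {k = 2} j (suc zero) = refl

-- Upper bound: a resonant set and a forcing set of the same size

module Construction {n : ℕ} {M : EdgeSet n} (pm : IsPerfectMatching M) where

  isAlternating : Face n → Bool
  isAlternating f = alternates (M (∂₁ f)) (M (∂₂ f)) (M (∂₃ f)) (M (∂₄ f))

  isAlternating-sound : ∀ f → isAlternating f ≡ true → Alternating M f
  isAlternating-sound f alt = alternatingBoundary⇒alternating M f (alternates-sound _ _ _ _ alt)

  blocked : Fin n → Bool
  blocked j = isAlternating (top j) ∨ isAlternating (bot j)

  -- mid (odd j) shares an edge with top j and bot j, which are always chosen when alternating.
  eligible : Fin (n * 2) → Bool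
  eligible i = isAlternating (mid i) ∧ not (atOdd blocked i)

  chosenMid : ℕ → Bool
  chosenMid = greedy (extend eligible)

  chosen : Face n → Bool
  chosen (mid i) = chosenMid (toℕ i)
  chosen (top j) = isAlternating (top j)
  chosen (bot j) = isAlternating (bot j)

  chosen-mid⇒eligible : ∀ i → chosen (mid i) ≡ true → eligible i ≡ true
  chosen-mid⇒eligible i c = trans (sym (extend-toℕ eligible i)) (greedy⇒eligible (extend eligible) (toℕ i) c)

  chosen⇒isAlternating : ∀ f → chosen f ≡ true → isAlternating f ≡ true
  chosen⇒isAlternating (mid i) c = ∧-conicalˡ _ _ (chosen-mid⇒eligible i c)
  chosen⇒isAlternating (top j) c = c
  chosen⇒isAlternating (bot j) c = c

  chosen⇒alternating : ∀ f → chosen f ≡ true → Alternating M f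
  chosen⇒alternating f c = isAlternating-sound f (chosen⇒isAlternating f c)

  chosen-oddMid⇒¬blocked : ∀ j → chosen (mid (odd j)) ≡ true → blocked j ≡ false
  chosen-oddMid⇒¬blocked j c = trans (sym (not-involutive _)) (cong not
    (subst (λ b → not b ≡ true) (atOdd-odd blocked j) (∧-conicalʳ _ _ (chosen-mid⇒eligible (odd j) c))))

  chosen-nonadjacent : ∀ {f g} → Adjacent f g → chosen f ≡ true → chosen g ≡ true → ⊥
  chosen-nonadjacent {mid i} {mid k} (mid-mid eq) cf cg =
    ≡true⇒≢false cf (greedy⇒¬greedy-pred _ (toℕ i) (subst (λ t → chosenMid t ≡ true) toℕk cg))
    where
    toℕk : toℕ k ≡ suc (toℕ i)
    toℕk = trans (sym (Fin.toℕ-inject₁ k)) (cong toℕ (sym eq))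
  chosen-nonadjacent (top-mid {j} refl) cf cg =
    ≡true⇒≢false cf (∨-conicalˡ _ _ (chosen-oddMid⇒¬blocked j cg))
  chosen-nonadjacent (bot-mid {j} refl) cf cg =
    ≡true⇒≢false cf (∨-conicalʳ _ _ (chosen-oddMid⇒¬blocked j cg))

  -- Two chosen faces through x would both contain the M-edge at x on their boundaries.
  chosen-disjoint : ∀ f g → f ≢ g → chosen f ≡ true → chosen g ≡ true → VertexDisjoint f g
  chosen-disjoint f g f≢g cf cg x x∈f x∈g
    with alternating⇒M-edge-at-corner M f (chosen⇒alternating f cf) x∈f
       | alternating⇒M-edge-at-corner M g (chosen⇒alternating g cg) x∈g
  ... | e , e∈∂f , Me , e∋x | e′ , e′∈∂g , Me′ , e′∋x
    with common-∂⇒adjacent f g e∈∂f (subst (_∈∂ g) (perfectMatching-unique pm Me′ Me e′∋x e∋x) e′∈∂g)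
  ... | inj₁ f≡g        = f≢g f≡g
  ... | inj₂ (inj₁ adj) = chosen-nonadjacent adj cf cg
  ... | inj₂ (inj₂ adj) = chosen-nonadjacent adj cg cf

  -- The corner of f that the left-to-right sweep in Forcing settles by means of f.
  anchor : Face n → Vtx n
  anchor (mid i) = U (suc i)
  anchor (top j) = U (suc (even j))
  anchor (bot j) = V (suc (even j))

  anchor-onFace : ∀ f → OnFace f (anchor f)
  anchor-onFace (mid i) = inj₁ (inj₂ refl)
  anchor-onFace (top j) = inj₂ (inj₂ (inj₂ (inj₂ refl)))
  anchor-onFace (bot j) = inj₂ (inj₂ (inj₂ (inj₁ refl)))

  representative : Face n → Edge n
  representative f = proj₁ (pm (anchor f))

  representative-M : ∀ f → M (representative f) ≡ true
  representative-M f = proj₁ (proj₂ (pm (anchor f)))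

  representative-anchor : ∀ f → Incident (representative f) (anchor f)
  representative-anchor f = proj₁ (proj₂ (proj₂ (pm (anchor f))))

  representative-∈∂ : ∀ f → chosen f ≡ true → representative f ∈∂ f
  representative-∈∂ f c =
    let e , e∈∂ , Me , e∋x = alternating⇒M-edge-at-corner M f (chosen⇒alternating f c) (anchor-onFace f)
    in subst (_∈∂ f) (perfectMatching-unique pm Me (representative-M f) e∋x (representative-anchor f)) e∈∂

  faces : List (Face n)
  faces = map mid (allFin (n * 2)) ++ map top (allFin n) ++ map bot (allFin n)

  ∈-faces : ∀ f → f ∈ faces
  ∈-faces (mid i) = ∈-++⁺ˡ (∈-map⁺ mid (∈-allFin i))
  ∈-faces (top j) = ∈-++⁺ʳ (map mid (allFin _)) (∈-++⁺ˡ (∈-map⁺ top (∈-allFin j)))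
  ∈-faces (bot j) = ∈-++⁺ʳ (map mid (allFin _)) (∈-++⁺ʳ (map top (allFin n)) (∈-map⁺ bot (∈-allFin j)))

  faces-unique : Unique faces
  faces-unique =
    Unique.++⁺ (Unique.map⁺ (λ { refl → refl }) (Unique.allFin⁺ _))
      (Unique.++⁺ (Unique.map⁺ (λ { refl → refl }) (Unique.allFin⁺ n))
                  (Unique.map⁺ (λ { refl → refl }) (Unique.allFin⁺ n)) tops∩bots=∅)
      mids∩others=∅
    where
    tops∩bots=∅ : ∀ {f} → ¬ (f ∈ map top (allFin n) × f ∈ map bot (allFin n))
    tops∩bots=∅ (p , q) with ∈-map⁻ top p | ∈-map⁻ bot q
    ... | _ , _ , refl | _ , _ , ()
    mids∩others=∅ : ∀ {f} → ¬ (f ∈ map mid (allFin _) × f ∈ map top (allFin n) ++ map bot (allFin n))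
    mids∩others=∅ (p , q) with ∈-map⁻ mid p | ∈-++⁻ (map top (allFin n)) q
    ... | _ , _ , refl | inj₁ q′ with () ← proj₂ (proj₂ (∈-map⁻ top q′))
    ... | _ , _ , refl | inj₂ q′ with () ← proj₂ (proj₂ (∈-map⁻ bot q′))

  chosen? : (f : Face n) → Dec (chosen f ≡ true)
  chosen? f = chosen f ≟ᴮ true

  chosenFaces : List (Face n)
  chosenFaces = filter chosen? faces

  chosenFaces-resonant : IsResonantSet M chosenFaces
  chosenFaces-resonant =
    allPairs-restrict (all-filter chosen? faces)
      (AllPairs.map (λ {f} {g} f≢g cf cg → chosen-disjoint f g f≢g cf cg) (Unique.filter⁺ chosen? faces-unique)) ,
    All.map (λ {f} → chosen⇒alternating f) (all-filter chosen? faces)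

  representatives : List (Edge n)
  representatives = map representative chosenFaces

  representative-∈ : ∀ f → chosen f ≡ true → representative f ∈ representatives
  representative-∈ f c = ∈-map⁺ representative (∈-filter⁺ chosen? (∈-faces f) c)

  representatives-unique : Unique representatives
  representatives-unique = AllPairs.map⁺ (allPairs-restrict (all-filter chosen? faces)
    (AllPairs.map (λ {f} {g} f∩g=∅ _ cg eq →
                     f∩g=∅ (anchor f) (anchor-onFace f)
                       (∈∂⇒onFace g (representative-∈∂ g cg)
                         (subst (λ e → Incident e (anchor f)) eq (representative-anchor f))))
                  (proj₁ chosenFaces-resonant)))

  representatives⊆M : All (λ e → M e ≡ true) representatives
  representatives⊆M = All.map⁺ (All.universal representative-M chosenFaces)

  matched-excludes : ∀ {a b x} → M a ≡ true → Incident a x → Incident b x → a ≢ b → M b ≡ false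
  matched-excludes Ma a∋x b∋x a≢b = ¬-not λ Mb → a≢b (perfectMatching-unique pm Ma Mb a∋x b∋x)

  partnerU : ∀ c → ∃[ e ] M e ≡ true × AtU c e
  partnerU c = let e , Me , e∋u , _ = pm (U c) in e , Me , atU e∋u

  partnerV : ∀ c → ∃[ e ] M e ≡ true × AtV c e
  partnerV c = let e , Me , e∋v , _ = pm (V c) in e , Me , atV e∋v

  partnerW : ∀ k → ∃[ e ] M e ≡ true × AtW k e
  partnerW k = let e , Me , e∋w , _ = pm (W k) in e , Me , atW e∋w

  partnerZ : ∀ k → ∃[ e ] M e ≡ true × AtZ k e
  partnerZ k = let e , Me , e∋z , _ = pm (Z k) in e , Me , atZ e∋z

  wuᵉ∉M⇒ww∈M : ∀ j → M (wu (even j)) ≡ false → M (ww j) ≡ true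
  wuᵉ∉M⇒ww∈M j Mwu with partnerW (even j)
  ... | _ , Me , right l eq = subst (λ l → M (ww l) ≡ true) (even-injective eq) Me
  ... | _ , Me , left l eq  = contradiction (sym eq) (even≢odd j l)
  ... | _ , Me , down       = ⊥-elim (≡true⇒≢false Me Mwu)

  ww∉M⇒wuᵒ∈M : ∀ j → M (ww j) ≡ false → M (wu (odd j)) ≡ true
  ww∉M⇒wuᵒ∈M j Mww with partnerW (odd j)
  ... | _ , Me , right l eq = contradiction eq (even≢odd l j)
  ... | _ , Me , left l eq  = ⊥-elim (≡true⇒≢false (subst (λ l → M (ww l) ≡ true) (odd-injective eq) Me) Mww)
  ... | _ , Me , down       = Me

  vzᵉ∉M⇒zz∈M : ∀ j → M (vz (even j)) ≡ false → M (zz j) ≡ true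
  vzᵉ∉M⇒zz∈M j Mvz with partnerZ (even j)
  ... | _ , Me , right l eq = subst (λ l → M (zz l) ≡ true) (even-injective eq) Me
  ... | _ , Me , left l eq  = contradiction (sym eq) (even≢odd j l)
  ... | _ , Me , up         = ⊥-elim (≡true⇒≢false Me Mvz)

  zz∉M⇒vzᵒ∈M : ∀ j → M (zz j) ≡ false → M (vz (odd j)) ≡ true
  zz∉M⇒vzᵒ∈M j Mzz with partnerZ (odd j)
  ... | _ , Me , right l eq = contradiction eq (even≢odd l j)
  ... | _ , Me , left l eq  = ⊥-elim (≡true⇒≢false (subst (λ l → M (zz l) ≡ true) (odd-injective eq) Me) Mzz)
  ... | _ , Me , up         = Me

  uuᵒ∋uᵉ : ∀ (j : Fin n) → Incident {n} (uu (odd j)) (U (suc (even j)))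
  uuᵒ∋uᵉ j = inj₁ (cong U (inject₁-odd j))

  vvᵒ∋vᵉ : ∀ (j : Fin n) → Incident {n} (vv (odd j)) (V (suc (even j)))
  vvᵒ∋vᵉ j = inj₁ (cong V (inject₁-odd j))

  top-alternating-by-uu : ∀ j → M (uu (odd j)) ≡ true → isAlternating (top j) ≡ true
  top-alternating-by-uu j Muu =
    alternates-complete (inj₁ (wuᵉ∉M⇒ww∈M j Mwuᵉ , matched-excludes Muu (inj₂ refl) (inj₂ refl) (λ ()) , Muu , Mwuᵉ))
    where
    Mwuᵉ : M (wu (even j)) ≡ false
    Mwuᵉ = matched-excludes Muu (uuᵒ∋uᵉ j) (inj₂ refl) (λ ())

  top-alternating-by-wu : ∀ j → M (wu (even j)) ≡ true → isAlternating (top j) ≡ true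
  top-alternating-by-wu j Mwu =
    alternates-complete (inj₂ (Mww , ww∉M⇒wuᵒ∈M j Mww , matched-excludes Mwu (inj₂ refl) (uuᵒ∋uᵉ j) (λ ()) , Mwu))
    where
    Mww : M (ww j) ≡ false
    Mww = matched-excludes Mwu (inj₁ refl) (inj₁ refl) (λ ())

  bot-alternating-by-vv : ∀ j → M (vv (odd j)) ≡ true → isAlternating (bot j) ≡ true
  bot-alternating-by-vv j Mvv =
    alternates-complete (inj₁ (vzᵉ∉M⇒zz∈M j Mvzᵉ , matched-excludes Mvv (inj₂ refl) (inj₁ refl) (λ ()) , Mvv , Mvzᵉ))
    where
    Mvzᵉ : M (vz (even j)) ≡ false
    Mvzᵉ = matched-excludes Mvv (vvᵒ∋vᵉ j) (inj₁ refl) (λ ())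

  bot-alternating-by-vz : ∀ j → M (vz (even j)) ≡ true → isAlternating (bot j) ≡ true
  bot-alternating-by-vz j Mvz =
    alternates-complete (inj₂ (Mzz , zz∉M⇒vzᵒ∈M j Mzz , matched-excludes Mvz (inj₁ refl) (vvᵒ∋vᵉ j) (λ ()) , Mvz))
    where
    Mzz : M (zz j) ≡ false
    Mzz = matched-excludes Mvz (inj₂ refl) (inj₁ refl) (λ ())

  ¬isAlternating₁₂ : ∀ f → M (∂₁ f) ≡ false → M (∂₂ f) ≡ false → isAlternating f ≡ false
  ¬isAlternating₁₂ f M₁ M₂ = ¬-not λ alt →
    [ (λ (M₁′ , _) → ≡true⇒≢false M₁′ M₁) , (λ (_ , M₂′ , _) → ≡true⇒≢false M₂′ M₂) ]
      (alternates-sound _ _ _ _ alt)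

  ¬isAlternating₃₄ : ∀ f → M (∂₃ f) ≡ false → M (∂₄ f) ≡ false → isAlternating f ≡ false
  ¬isAlternating₃₄ f M₃ M₄ = ¬-not λ alt →
    [ (λ (_ , _ , M₃′ , _) → ≡true⇒≢false M₃′ M₃) , (λ (_ , _ , _ , M₄′) → ≡true⇒≢false M₄′ M₄) ]
      (alternates-sound _ _ _ _ alt)

  ¬isAlternating⇒¬chosen : ∀ f → isAlternating f ≡ false → chosen f ≡ false
  ¬isAlternating⇒¬chosen f ¬alt = ¬-not λ c → ≡true⇒≢false (chosen⇒isAlternating f c) ¬alt

  private
    chosenMid-at : ∀ {t} (i : Fin (n * 2)) → toℕ i ≡ t → chosenMid t ≡ true → chosen (mid i) ≡ true
    chosenMid-at i refl c = c

    eligible-even : ∀ (j : Fin n) → isAlternating (mid (even j)) ≡ true → eligible (even j) ≡ true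
    eligible-even j alt rewrite alt | atOdd-even blocked j = refl

    extend-eligible : ∀ {t} (i : Fin (n * 2)) → toℕ i ≡ t → eligible i ≡ true → extend eligible t ≡ true
    extend-eligible i refl el = trans (extend-toℕ eligible i) el

  chosen-first-mid : ∀ {i} → inject₁ i ≡ zero → isAlternating (mid i) ≡ true → chosen (mid i) ≡ true
  chosen-first-mid {i} eq alt with inject₁≡zero⇒even {n} eq
  ... | l , refl = chosenMid-at (even l) toℕ≡0 (extend-eligible (even l) toℕ≡0 (eligible-even l alt))
    where
    toℕ≡0 : toℕ (even l) ≡ 0
    toℕ≡0 = trans (sym (Fin.toℕ-inject₁ (even l))) (cong toℕ eq)

  chosen-mid-after-odd : ∀ {i} (j : Fin n) → inject₁ i ≡ suc (odd j) → isAlternating (mid i) ≡ true →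
                         chosen (mid (odd j)) ≡ false → chosen (mid i) ≡ true
  chosen-mid-after-odd {i} j eq alt ¬c with inject₁≡suc-odd⇒even j eq
  ... | l , refl = chosenMid-at (even l) toℕ≡
                     (greedy-intro (extend eligible) (toℕ (odd j)) (extend-eligible (even l) toℕ≡ (eligible-even l alt)) ¬c)
    where
    toℕ≡ : toℕ (even l) ≡ suc (toℕ (odd j))
    toℕ≡ = trans (sym (Fin.toℕ-inject₁ (even l))) (cong toℕ eq)

  chosen-odd-mid : ∀ j → isAlternating (mid (odd j)) ≡ true → isAlternating (top j) ≡ false →
                   isAlternating (bot j) ≡ false → chosen (mid (even j)) ≡ false → chosen (mid (odd j)) ≡ true
  chosen-odd-mid j alt ¬top ¬bot ¬c = chosenMid-at (odd j) toℕ≡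
    (greedy-intro (extend eligible) (toℕ (even j)) (extend-eligible (odd j) toℕ≡ eligible-odd) ¬c)
    where
    toℕ≡ : toℕ (odd j) ≡ suc (toℕ (even j))
    toℕ≡ = trans (toℕ-odd j) (cong suc (sym (toℕ-even j)))
    eligible-odd : eligible (odd j) ≡ true
    eligible-odd rewrite alt | atOdd-odd blocked j | ¬top | ¬bot = refl

  module Forcing {M′ : EdgeSet n} (pm′ : IsPerfectMatching M′)
                 (representatives⊆M′ : All (λ e → M′ e ≡ true) representatives) where

    Settled : Vtx n → Set
    Settled x = ∀ e → Incident e x → M e ≡ M′ e

    settled-by-shared : ∀ {s x} → Incident s x → M s ≡ true → M′ s ≡ true → Settled x
    settled-by-shared s∋x Ms M′s e e∋x with M e in Me
    ... | true  = sym (trans (cong M′ (perfectMatching-unique pm Me Ms e∋x s∋x)) M′s)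
    ... | false with M′ e in M′e
    ...   | false = refl
    ...   | true  = ⊥-elim (≡true⇒≢false (trans (cong M (perfectMatching-unique pm′ M′e M′s e∋x s∋x)) Ms) Me)

    settled-along : ∀ {e x y} → M e ≡ true → Incident e x → Incident e y → Settled x → Settled y
    settled-along Me e∋x e∋y settled-x = settled-by-shared e∋y Me (trans (sym (settled-x _ e∋x)) Me)

    -- The M′-edge at x is in M, for otherwise its other end y would see M and M′ differ.
    settled-by-neighbours : ∀ {x} → (∀ {e} → Incident e x → M e ≡ false → ∃[ y ] Incident e y × Settled y) →
                            Settled x
    settled-by-neighbours {x} neighbour with pm′ x
    ... | e , M′e , e∋x , _ with M e in Me
    ...   | true  = settled-by-shared e∋x Me M′e
    ...   | false = let _ , e∋y , settled-y = neighbour e∋x Me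
                    in ⊥-elim (≡true⇒≢false M′e (trans (sym (settled-y e e∋y)) Me))

    chosen⇒settled : ∀ f → chosen f ≡ true → Settled (anchor f)
    chosen⇒settled f c = settled-by-shared (representative-anchor f) (representative-M f)
                           (All.lookup representatives⊆M′ (representative-∈ f c))

    settledU : ∀ {c} →
      (∀ i → suc i ≡ c → M (uu i) ≡ false → Settled (U (inject₁ i))) →
      (∀ i → inject₁ i ≡ c → M (uu i) ≡ false → Settled (U (suc i))) →
      (M (uv c) ≡ false → Settled (V c)) →
      (∀ i → suc i ≡ c → M (wu i) ≡ false → Settled (W i)) → Settled (U c)
    settledU {c} hˡ hʳ hᵈ hᵘ = settled-by-neighbours λ e∋u → neighbour (atU e∋u)
      where
      neighbour : ∀ {e} → AtU c e → M e ≡ false → ∃[ y ] Incident e y × Settled y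
      neighbour (left i p)  Me = U (inject₁ i) , inj₁ refl , hˡ i p Me
      neighbour (right i p) Me = U (suc i) , inj₂ refl , hʳ i p Me
      neighbour down        Me = V c , inj₂ refl , hᵈ Me
      neighbour (up i p)    Me = W i , inj₁ refl , hᵘ i p Me

    settledV : ∀ {c} →
      (∀ i → suc i ≡ c → M (vv i) ≡ false → Settled (V (inject₁ i))) →
      (∀ i → inject₁ i ≡ c → M (vv i) ≡ false → Settled (V (suc i))) →
      (M (uv c) ≡ false → Settled (U c)) →
      (∀ i → suc i ≡ c → M (vz i) ≡ false → Settled (Z i)) → Settled (V c)
    settledV {c} hˡ hʳ hᵘ hᵈ = settled-by-neighbours λ e∋v → neighbour (atV e∋v)
      where
      neighbour : ∀ {e} → AtV c e → M e ≡ false → ∃[ y ] Incident e y × Settled y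
      neighbour (left i p)  Me = V (inject₁ i) , inj₁ refl , hˡ i p Me
      neighbour (right i p) Me = V (suc i) , inj₂ refl , hʳ i p Me
      neighbour up          Me = U c , inj₁ refl , hᵘ Me
      neighbour (down i p)  Me = Z i , inj₂ refl , hᵈ i p Me

    settledW : ∀ {k} →
      (∀ j → even j ≡ k → M (ww j) ≡ false → Settled (W (odd j))) →
      (∀ j → odd j ≡ k → M (ww j) ≡ false → Settled (W (even j))) →
      (M (wu k) ≡ false → Settled (U (suc k))) → Settled (W k)
    settledW {k} hʳ hˡ hᵈ = settled-by-neighbours λ e∋w → neighbour (atW e∋w)
      where
      neighbour : ∀ {e} → AtW k e → M e ≡ false → ∃[ y ] Incident e y × Settled y
      neighbour (right j p) Me = W (odd j) , inj₂ refl , hʳ j p Me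
      neighbour (left j p)  Me = W (even j) , inj₁ refl , hˡ j p Me
      neighbour down        Me = U (suc k) , inj₂ refl , hᵈ Me

    settledZ : ∀ {k} →
      (∀ j → even j ≡ k → M (zz j) ≡ false → Settled (Z (odd j))) →
      (∀ j → odd j ≡ k → M (zz j) ≡ false → Settled (Z (even j))) →
      (M (vz k) ≡ false → Settled (V (suc k))) → Settled (Z k)
    settledZ {k} hʳ hˡ hᵘ = settled-by-neighbours λ e∋z → neighbour (atZ e∋z)
      where
      neighbour : ∀ {e} → AtZ k e → M e ≡ false → ∃[ y ] Incident e y × Settled y
      neighbour (right j p) Me = Z (odd j) , inj₂ refl , hʳ j p Me
      neighbour (left j p)  Me = Z (even j) , inj₁ refl , hˡ j p Me
      neighbour up          Me = V (suc k) , inj₁ refl , hᵘ Me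

    settled-right-of-vertical : ∀ {i} → (Σ (Fin n) λ l → i ≡ even l) → M (uv (inject₁ i)) ≡ true →
                                (isAlternating (mid i) ≡ true → chosen (mid i) ≡ true) → Settled (U (suc i))
    settled-right-of-vertical (l , refl) Muv intro with partnerU (suc (even l))
    ... | _ , Me , left _ refl = ⊥-elim (≡true⇒≢false Me (matched-excludes Muv (inj₁ refl) (inj₁ refl) (λ ())))
    ... | _ , Me , right i p   = chosen⇒settled (top l)
                                   (top-alternating-by-uu l (subst (λ i → M (uu i) ≡ true) (inject₁≡suc-even⇒odd l p) Me))
    ... | _ , Me , up _ refl   = chosen⇒settled (top l) (top-alternating-by-wu l Me)
    ... | _ , Me , down        = chosen⇒settled (mid (even l)) (intro (alternates-complete
          (inj₂ (matched-excludes Muv (inj₁ refl) (inj₁ refl) (λ ()) , Me ,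
                 matched-excludes Muv (inj₂ refl) (inj₁ refl) (λ ()) , Muv))))

    -- Column 2j+1, given column 2j.
    module OddColumn (j : Fin n) (settled-uˡ : Settled (U (inject₁ (even j))))
                     (settled-vˡ : Settled (V (inject₁ (even j)))) where

      module Vertical (Muv : M (uv (suc (even j))) ≡ true) where
        Muuᵒ : M (uu (odd j)) ≡ false
        Muuᵒ = matched-excludes Muv (inj₁ refl) (uuᵒ∋uᵉ j) (λ ())
        Mwuᵉ : M (wu (even j)) ≡ false
        Mwuᵉ = matched-excludes Muv (inj₁ refl) (inj₂ refl) (λ ())
        Mvvᵒ : M (vv (odd j)) ≡ false
        Mvvᵒ = matched-excludes Muv (inj₂ refl) (vvᵒ∋vᵉ j) (λ ())
        Mvzᵉ : M (vz (even j)) ≡ false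
        Mvzᵉ = matched-excludes Muv (inj₂ refl) (inj₁ refl) (λ ())

        uu⇒vv : ∀ {i} → inject₁ i ≡ suc (odd j) → M (uu i) ≡ true → M (vv i) ≡ true
        uu⇒vv {i} p Muu with partnerV (suc (odd j))
        ... | _ , Me , left _ refl = ⊥-elim (≡true⇒≢false Me Mvvᵒ)
        ... | _ , Me , right i′ p′ = subst (λ i → M (vv i) ≡ true) (Fin.inject₁-injective (trans p′ (sym p))) Me
        ... | _ , Me , up          = ⊥-elim (≡true⇒≢false Me (matched-excludes Muu (inj₁ (cong U p)) (inj₁ refl) (λ ())))
        ... | _ , Me , down _ refl =
          ⊥-elim (≡true⇒≢false Me (matched-excludes (vzᵉ∉M⇒zz∈M j Mvzᵉ) (inj₂ refl) (inj₂ refl) (λ ())))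

        -- Either mid (even j) is chosen, or the greedy choice settles u_{2j+2} from mid (odd j) or mid (2j+2).
        settled-here-or-right : Settled (U (suc (even j))) ⊎ Settled (U (suc (odd j)))
        settled-here-or-right with partnerU (suc (odd j))
        ... | _ , Me , left _ refl = ⊥-elim (≡true⇒≢false Me Muuᵒ)
        ... | _ , Me , up _ refl   =
          ⊥-elim (≡true⇒≢false Me (matched-excludes (wuᵉ∉M⇒ww∈M j Mwuᵉ) (inj₂ refl) (inj₁ refl) (λ ())))
        ... | _ , Me , down with chosen (mid (even j)) in c
        ...   | true  = inj₁ (chosen⇒settled (mid (even j)) c)
        ...   | false = inj₂ (chosen⇒settled (mid (odd j))
                          (chosen-odd-mid j alt (¬isAlternating₃₄ (top j) Muuᵒ Mwuᵉ)
                                                (¬isAlternating₃₄ (bot j) Mvvᵒ Mvzᵉ) c))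
          where
          alt : isAlternating (mid (odd j)) ≡ true
          alt = alternates-complete (inj₂ (Muuᵒ , Me , Mvvᵒ , trans (cong (λ c → M (uv c)) (inject₁-odd j)) Muv))
        settled-here-or-right | _ , Me , right i p =
          inj₂ (settled-along Me (inj₂ refl) (inj₁ (cong U p)) (chosen⇒settled (mid i) (chosen-mid-after-odd j p alt ¬chosen)))
          where
          alt : isAlternating (mid i) ≡ true
          alt = alternates-complete (inj₁ (Me , matched-excludes Me (inj₂ refl) (inj₁ refl) (λ ()) ,
                                           uu⇒vv p Me , matched-excludes Me (inj₁ refl) (inj₁ refl) (λ ())))
          ¬chosen : chosen (mid (odd j)) ≡ false
          ¬chosen = ¬isAlternating⇒¬chosen (mid (odd j)) (¬isAlternating₁₂ (mid (odd j)) Muuᵒ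
                      (matched-excludes Me (inj₁ (cong U p)) (inj₁ refl) (λ ())))

        settled-from-right : Settled (U (suc (odd j))) → Settled (U (suc (even j)))
        settled-from-right settled-uʳ =
          settledU (λ { _ refl _ → settled-uˡ })
                   (λ i p _ → subst (λ i → Settled (U (suc i))) (sym (inject₁≡suc-even⇒odd j p)) settled-uʳ)
                   (λ Muv′ → ⊥-elim (≡true⇒≢false Muv Muv′))
                   (λ { _ refl _ → settled-along Mww (inj₂ refl) (inj₁ refl) settled-wʳ })
          where
          Mww : M (ww j) ≡ true
          Mww = wuᵉ∉M⇒ww∈M j Mwuᵉ
          settled-wʳ : Settled (W (odd j))
          settled-wʳ = settledW (λ l p _ → contradiction p (even≢odd l j))
                         (λ l p Mww′ → ⊥-elim (≡true⇒≢false
                            (subst (λ l → M (ww l) ≡ true) (sym (odd-injective p)) Mww) Mww′))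
                         (λ _ → settled-uʳ)

      settled-u : Settled (U (suc (even j)))
      settled-u with partnerU (suc (even j))
      ... | _ , Me , left _ refl = settled-along Me (inj₁ refl) (inj₂ refl) settled-uˡ
      ... | _ , Me , right i p   = chosen⇒settled (top j)
                                     (top-alternating-by-uu j (subst (λ i → M (uu i) ≡ true) (inject₁≡suc-even⇒odd j p) Me))
      ... | _ , Me , up _ refl   = chosen⇒settled (top j) (top-alternating-by-wu j Me)
      ... | _ , Me , down        = [ id , settled-from-right ] settled-here-or-right
        where open Vertical Me

      settled-v : Settled (V (suc (even j)))
      settled-v with partnerV (suc (even j))
      ... | _ , Me , left _ refl = settled-along Me (inj₁ refl) (inj₂ refl) settled-vˡ
      ... | _ , Me , right i p   = chosen⇒settled (bot j)
                                     (bot-alternating-by-vv j (subst (λ i → M (vv i) ≡ true) (inject₁≡suc-even⇒odd j p) Me))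
      ... | _ , Me , up          = settled-along Me (inj₁ refl) (inj₂ refl) settled-u
      ... | _ , Me , down _ refl = chosen⇒settled (bot j) (bot-alternating-by-vz j Me)

      settled-w : Settled (W (even j))
      settled-w with M (wu (even j)) in Mwu
      ... | true  = settled-along Mwu (inj₂ refl) (inj₁ refl) settled-u
      ... | false = settledW
          (λ l p Mww → ⊥-elim (≡true⇒≢false
             (subst (λ l → M (ww l) ≡ true) (sym (even-injective p)) (wuᵉ∉M⇒ww∈M j Mwu)) Mww))
          (λ l p _ → contradiction (sym p) (even≢odd j l))
          (λ _ → settled-u)

      settled-z : Settled (Z (even j))
      settled-z with M (vz (even j)) in Mvz
      ... | true  = settled-along Mvz (inj₁ refl) (inj₂ refl) settled-v
      ... | false = settledZ
          (λ l p Mzz → ⊥-elim (≡true⇒≢false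
             (subst (λ l → M (zz l) ≡ true) (sym (even-injective p)) (vzᵉ∉M⇒zz∈M j Mvz)) Mzz))
          (λ l p _ → contradiction (sym p) (even≢odd j l))
          (λ _ → settled-v)

    -- Column 2j+2, given column 2j+1.
    module EvenColumn (j : Fin n) (settled-uˡ : Settled (U (inject₁ (odd j))))
                      (settled-vˡ : Settled (V (inject₁ (odd j))))
                      (settled-wˡ : Settled (W (even j))) (settled-zˡ : Settled (Z (even j))) where

      settled-w : Settled (W (odd j))
      settled-w with partnerW (odd j)
      ... | _ , Me , right l p = contradiction p (even≢odd l j)
      ... | _ , Me , left l p  = settled-along Me (inj₁ refl) (inj₂ (cong W p))
                                   (subst (λ (l : Fin n) → Settled (W (even l))) (sym (odd-injective p)) settled-wˡ)
      ... | _ , Me , down      = settledW (λ l p _ → contradiction p (even≢odd l j))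
                                   (λ l p _ → subst (λ (l : Fin n) → Settled (W (even l))) (sym (odd-injective p)) settled-wˡ)
                                   (λ Mwu → ⊥-elim (≡true⇒≢false Me Mwu))

      settled-z : Settled (Z (odd j))
      settled-z with partnerZ (odd j)
      ... | _ , Me , right l p = contradiction p (even≢odd l j)
      ... | _ , Me , left l p  = settled-along Me (inj₁ refl) (inj₂ (cong Z p))
                                   (subst (λ (l : Fin n) → Settled (Z (even l))) (sym (odd-injective p)) settled-zˡ)
      ... | _ , Me , up        = settledZ (λ l p _ → contradiction p (even≢odd l j))
                                   (λ l p _ → subst (λ (l : Fin n) → Settled (Z (even l))) (sym (odd-injective p)) settled-zˡ)
                                   (λ Mvz → ⊥-elim (≡true⇒≢false Me Mvz))

      module RightEdge {i} (p : inject₁ i ≡ suc (odd j)) (Muu : M (uu i) ≡ true) where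
        settled-u-given-v : Settled (V (suc (odd j))) → Settled (U (suc (odd j)))
        settled-u-given-v settled-v =
          settledU (λ { _ refl _ → settled-uˡ })
                   (λ i′ p′ Muu′ → ⊥-elim (≡true⇒≢false
                      (subst (λ i → M (uu i) ≡ true) (Fin.inject₁-injective (trans p (sym p′))) Muu) Muu′))
                   (λ _ → settled-v)
                   (λ { _ refl _ → settled-w })

        settled-u : Settled (U (suc (odd j)))
        settled-u with partnerV (suc (odd j))
        ... | _ , Me , left _ refl = settled-u-given-v (settled-along Me (inj₁ refl) (inj₂ refl) settled-vˡ)
        ... | _ , Me , down _ refl = settled-u-given-v (settled-along Me (inj₂ refl) (inj₁ refl) settled-z)
        ... | _ , Me , up          = ⊥-elim (≡true⇒≢false Me (matched-excludes Muu (inj₁ (cong U p)) (inj₁ refl) (λ ())))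
        ... | _ , Me , right i′ p′ =
          settled-along Muu (inj₂ refl) (inj₁ (cong U p)) (chosen⇒settled (mid i) (chosen-mid-after-odd j p alt ¬chosen))
          where
          alt : isAlternating (mid i) ≡ true
          alt = alternates-complete (inj₁ (Muu , matched-excludes Muu (inj₂ refl) (inj₁ refl) (λ ()) ,
                  subst (λ i → M (vv i) ≡ true) (Fin.inject₁-injective (trans p′ (sym p))) Me ,
                  matched-excludes Muu (inj₁ refl) (inj₁ refl) (λ ())))
          uu≢uuᵒ : uu i ≢ uu (odd j)
          uu≢uuᵒ refl = inject₁≢suc (odd j) p
          ¬chosen : chosen (mid (odd j)) ≡ false
          ¬chosen = ¬isAlternating⇒¬chosen (mid (odd j)) (¬isAlternating₁₂ (mid (odd j))
                      (matched-excludes Muu (inj₁ (cong U p)) (inj₂ refl) uu≢uuᵒ)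
                      (matched-excludes Muu (inj₁ (cong U p)) (inj₁ refl) (λ ())))

      settled-u : Settled (U (suc (odd j)))
      settled-u with partnerU (suc (odd j))
      ... | _ , Me , left _ refl = settled-along Me (inj₁ refl) (inj₂ refl) settled-uˡ
      ... | _ , Me , up _ refl   = settled-along Me (inj₁ refl) (inj₂ refl) settled-w
      ... | _ , Me , right i p   = RightEdge.settled-u p Me
      ... | _ , Me , down with chosen (mid (odd j)) in c
      ...   | true  = chosen⇒settled (mid (odd j)) c
      ...   | false = settledU
          (λ { _ refl _ → settled-uˡ })
          (λ i p _ → settled-right-of-vertical (inject₁≡suc-odd⇒even j p) (subst (λ c → M (uv c) ≡ true) (sym p) Me)
                       (λ alt → chosen-mid-after-odd j p alt c))
          (λ Muv → ⊥-elim (≡true⇒≢false Me Muv))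
          (λ { _ refl _ → settled-w })

      settled-v : Settled (V (suc (odd j)))
      settled-v with partnerV (suc (odd j))
      ... | _ , Me , left _ refl = settled-along Me (inj₁ refl) (inj₂ refl) settled-vˡ
      ... | _ , Me , down _ refl = settled-along Me (inj₂ refl) (inj₁ refl) settled-z
      ... | _ , Me , up          = settled-along Me (inj₁ refl) (inj₂ refl) settled-u
      ... | _ , Me , right i p   = settledV
          (λ { _ refl _ → settled-vˡ })
          (λ i′ p′ Mvv′ → ⊥-elim (≡true⇒≢false
             (subst (λ i → M (vv i) ≡ true) (Fin.inject₁-injective (trans p (sym p′))) Me) Mvv′))
          (λ _ → settled-u)
          (λ { _ refl _ → settled-z })

    settled-u₀ : Settled (U zero)
    settled-u₀ with partnerU zero
    ... | _ , _ , left _ ()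
    ... | _ , _ , up _ ()
    ... | _ , Me , down = settledU
        (λ _ ())
        (λ i p _ → settled-right-of-vertical (inject₁≡zero⇒even p) (subst (λ c → M (uv c) ≡ true) (sym p) Me)
                     (chosen-first-mid p))
        (λ Muv → ⊥-elim (≡true⇒≢false Me Muv))
        (λ _ ())
    ... | _ , Me , right i p with partnerV zero
    ...   | _ , _ , left _ ()
    ...   | _ , _ , down _ ()
    ...   | _ , Me′ , up = ⊥-elim (≡true⇒≢false Me′ (matched-excludes Me (inj₁ (cong U p)) (inj₁ refl) (λ ())))
    ...   | _ , Me′ , right i′ p′ =
      settled-along Me (inj₂ refl) (inj₁ (cong U p)) (chosen⇒settled (mid i) (chosen-first-mid p alt))
      where
      alt : isAlternating (mid i) ≡ true
      alt = alternates-complete (inj₁ (Me , matched-excludes Me (inj₂ refl) (inj₁ refl) (λ ()) ,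
              subst (λ i → M (vv i) ≡ true) (Fin.inject₁-injective (trans p′ (sym p))) Me′ ,
              matched-excludes Me (inj₁ refl) (inj₁ refl) (λ ())))

    settled-v₀ : Settled (V zero)
    settled-v₀ with partnerV zero
    ... | _ , _ , left _ ()
    ... | _ , _ , down _ ()
    ... | _ , Me , up      = settled-along Me (inj₁ refl) (inj₂ refl) settled-u₀
    ... | _ , Me , right i p = settledV
        (λ _ ())
        (λ i′ p′ Mvv′ → ⊥-elim (≡true⇒≢false
           (subst (λ i → M (vv i) ≡ true) (Fin.inject₁-injective (trans p (sym p′))) Me) Mvv′))
        (λ _ → settled-u₀)
        (λ _ ())

    column : Vtx n → ℕ
    column (U c) = toℕ c
    column (V c) = toℕ c
    column (W k) = suc (toℕ k)
    column (Z k) = suc (toℕ k)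

    SettledBefore : ℕ → Set
    SettledBefore c = ∀ x → column x < c → Settled x

    settled-column : ∀ k → Settled (U (suc k)) → Settled (V (suc k)) → Settled (W k) → Settled (Z k) →
                     ∀ x → column x ≡ suc (toℕ k) → Settled x
    settled-column k su sv sw sz (U c) eq = subst (Settled ∘ U) (sym (Fin.toℕ-injective {j = suc k} eq)) su
    settled-column k su sv sw sz (V c) eq = subst (Settled ∘ V) (sym (Fin.toℕ-injective {j = suc k} eq)) sv
    settled-column k su sv sw sz (W i) eq = subst (Settled ∘ W) (sym (Fin.toℕ-injective (ℕ.suc-injective eq))) sw
    settled-column k su sv sw sz (Z i) eq = subst (Settled ∘ Z) (sym (Fin.toℕ-injective (ℕ.suc-injective eq))) sz

    module Columns (k : ℕ) (k<n : k < n) (before : SettledBefore (suc (2 * k))) where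
      j : Fin n
      j = Fin.fromℕ< k<n

      toℕ-even-j : toℕ (even j) ≡ 2 * k
      toℕ-even-j = trans (toℕ-even j) (cong (2 *_) (Fin.toℕ-fromℕ< k<n))

      toℕ-odd-j : toℕ (odd j) ≡ suc (2 * k)
      toℕ-odd-j = trans (toℕ-odd j) (cong (λ t → suc (2 * t)) (Fin.toℕ-fromℕ< k<n))

      left-of-j : ∀ x → column x ≡ toℕ (inject₁ (even j)) → Settled x
      left-of-j x eq = before x (ℕ.≤-reflexive (cong suc (trans eq (trans (Fin.toℕ-inject₁ (even j)) toℕ-even-j))))

      module O = OddColumn j (left-of-j _ refl) (left-of-j _ refl)
      module E = EvenColumn j (subst (Settled ∘ U) (sym (inject₁-odd j)) O.settled-u)
                              (subst (Settled ∘ V) (sym (inject₁-odd j)) O.settled-v) O.settled-w O.settled-z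

    settled-before-1 : SettledBefore 1
    settled-before-1 (U zero) _ = settled-u₀
    settled-before-1 (V zero) _ = settled-v₀
    settled-before-1 (U (suc _)) (s≤s ())
    settled-before-1 (V (suc _)) (s≤s ())
    settled-before-1 (W _) (s≤s ())
    settled-before-1 (Z _) (s≤s ())

    settled-before-step : ∀ k → k < n → SettledBefore (suc (2 * k)) → SettledBefore (suc (suc (suc (2 * k))))
    settled-before-step k k<n before x lt with ℕ.m<1+n⇒m<n∨m≡n lt
    ... | inj₂ at-even = settled-column (odd j) E.settled-u E.settled-v E.settled-w E.settled-z x
                           (trans at-even (cong suc (sym toℕ-odd-j)))
      where open Columns k k<n before
    ... | inj₁ lt′ with ℕ.m<1+n⇒m<n∨m≡n lt′
    ...   | inj₁ lt″   = before x lt″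
    ...   | inj₂ at-odd = settled-column (even j) O.settled-u O.settled-v O.settled-w O.settled-z x
                            (trans at-odd (cong suc (sym toℕ-even-j)))
      where open Columns k k<n before

    settled-before : ∀ k → k ≤ n → SettledBefore (suc (2 * k))
    settled-before zero    _   = settled-before-1
    settled-before (suc k) k<n = subst SettledBefore (cong suc (sym (ℕ.*-suc 2 k)))
      (settled-before-step k k<n (settled-before k (ℕ.<⇒≤ k<n)))

    column< : ∀ x → column x < suc (2 * n)
    column< (U c) = subst (λ m → toℕ c < suc m) (ℕ.*-comm n 2) (Fin.toℕ<n c)
    column< (V c) = subst (λ m → toℕ c < suc m) (ℕ.*-comm n 2) (Fin.toℕ<n c)
    column< (W k) = subst (λ m → suc (toℕ k) < suc m) (ℕ.*-comm n 2) (s≤s (Fin.toℕ<n k))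
    column< (Z k) = subst (λ m → suc (toℕ k) < suc m) (ℕ.*-comm n 2) (s≤s (Fin.toℕ<n k))

    M′≗M : ∀ e → M′ e ≡ M e
    M′≗M e = let x = proj₁ (ends e) in sym (settled-before n ℕ.≤-refl x (column< x) e (inj₁ refl))

  representatives-forcing : IsForcingSet M representatives
  representatives-forcing = representatives-unique , representatives⊆M , λ M′ pm′ ⊆M′ → Forcing.M′≗M pm′ ⊆M′

-- The argument also covers n = 0.
lemma2p6 : (n : ℕ) → 1 ≤ n → (M : EdgeSet n) → IsPerfectMatching M →
    Σ ℕ λ k → ForcingNumberIs M k × ResonanceNumberIs M k
lemma2p6 n _ M pm =
  length chosenFaces ,
  ((representatives , representatives-forcing , length-map representative chosenFaces) ,
   λ S forcing → resonant≤forcing pm forcing chosenFaces-resonant) ,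
  ((chosenFaces , chosenFaces-resonant , refl) ,
   λ R resonant → subst (length R ≤_) (length-map representative chosenFaces)
                    (resonant≤forcing pm representatives-forcing resonant))
  where open Construction pm
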